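{- Let $t$ be a checkers term with $\Gamma\vdash^kt:L$ derivable, and suppose $(\Gamma',L')\le^-_{k_1}(\Gamma,L)$ for some $k_1\ge0$. Then there exist $\Gamma''$, $L''$, $k'$ and $k_2$ with $0\le k_2\le k_1$ such that $\Gamma''\vdash^{k'}t:L''$ is derivable, $(\Gamma'',L'')\le^+_{k_2}(\Gamma',L')$, and $|k-k'|\le k_1-k_2$.
   Context: Checkers terms: $t ::= x\mid\lambda_cx.t\mid t\cdot^cu$, $c\in\{\circ,\bullet\}$. Types: linear $L ::= X\mid M\to_cL$; multi $M ::= [L_1,\ldots,L_n]$ (finite multisets); environments $\Gamma$ (finite support), pointwise $+$, $\Gamma,x:M$ with $x\notin\mathrm{supp}(\Gamma)$. Rules: (ax) $x:[L]\vdash^0x:L$; (many) from $\Gamma_i\vdash^{k_i}t:L_i$ ($i\in I$ finite) infer $\sum\Gamma_i\vdash^{\sum k_i}t:[L_i]_{i\in I}$; ($\lambda$) from $\Gamma,x:M\vdash^kt:L$ infer $\Gamma\vdash^k\lambda_cx.t:M\to_cL$; (@) from $\Gamma\vdash^{k_1}t:M\to_cL$ and $\Delta\vdash^{k_2}u:M$ infer $\Gamma+\Delta\vdash^kt\cdot^du:L$, $k=k_1+k_2$ if $c=d$, else $k_1+k_2+1$. Polarized whitening $\le^a_k$ ($a\in\{+,-\}$, $\bar a$ opposite), on linear and multi types by mutual induction: $X\le^a_0X$; if $M'\le^-_{k_1}M$, $L'\le^+_{k_2}L$ then $(M'\to_\circ L')\le^+_{k_1+k_2+1}(M\to_\bullet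 L)$; for any $c$, if $M'\le^{\bar a}_{k_1}M$, $L'\le^a_{k_2}L$ then $(M'\to_cL')\le^a_{k_1+k_2}(M\to_cL)$; $[L'_1,\ldots,L'_n]\le^a_{\sum k_i}[L_1,\ldots,L_n]$ when $L'_i\le^a_{k_i}L_i$; no other rules. Environments pointwise with summed indices. Pairs: $(\Gamma',L')\le^a_{k_1+k_2}(\Gamma,L)$ iff $\Gamma'\le^{\bar a}_{k_1}\Gamma$ and $L'\le^a_{k_2}L$. -}

module Defs where

open import Data.Nat using (ℕ; zero; suc; _+_; _≤_; _≟_)
open import Data.List using (List; []; _∷_; _++_)
open import Data.Product using (Σ; _×_; _,_; ∃-syntax)
open import Relation.Nullary using (¬_; yes; no)
open import Relation.Binary.PropositionalEquality using (_≡_)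

data Col : Set where
  ∘ ● : Col

data Term : Set where
  var : ℕ → Term
  lam : Col → ℕ → Term → Term
  app : Term → Col → Term → Term

-- Types.  Linear types  L ::= X | M →_c L,  multi types M = finite
-- multisets of linear types, represented by lists; multiset equality
-- is the (nested) permutation equivalence _≈L_/_≈M_ below.

data Lin : Set where
  tvar : ℕ → Lin
  arr  : List Lin → Col → Lin → Lin

Multi : Set
Multi = List Lin

mutual
  data _≈L_ : Lin → Lin → Set where
    ≈tvar : ∀ {X} → tvar X ≈L tvar X
    ≈arr  : ∀ {M M' L L' c} → M ≈M M' → L ≈L L' → arr M c L ≈L arr M' c L'

  data _≈M_ : Multi → Multi → Set where
    ≈nil  : [] ≈M []
    ≈cons : ∀ {L L' M xs ys} → L ≈L L' → M ≈M (xs ++ ys) →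
            (L ∷ M) ≈M (xs ++ L' ∷ ys)

-- Environments: maps from variables to multi types (finite support is
-- automatic for typable environments and enforced in whitening below).

Env : Set
Env = ℕ → Multi

∅ : Env
∅ _ = []

_⊕_ : Env → Env → Env
(Γ ⊕ Δ) x = Γ x ++ Δ x

single : ℕ → Lin → Env
single x L y with y ≟ x
... | yes _ = L ∷ []
... | no  _ = []

-- Γ , x : M   (used only when x ∉ supp Γ, i.e. Γ x ≡ [])
_,_∶_ : Env → ℕ → Multi → Env
(Γ , x ∶ M) y with y ≟ x
... | yes _ = M
... | no  _ = Γ y

_≈E_ : Env → Env → Set
Γ ≈E Δ = ∀ x → Γ x ≈M Δ x

cost : Col → Col → ℕ → ℕ → ℕ
cost ∘ ∘ k₁ k₂ = k₁ + k₂
cost ● ● k₁ k₂ = k₁ + k₂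
cost ∘ ● k₁ k₂ = suc (k₁ + k₂)
cost ● ∘ k₁ k₂ = suc (k₁ + k₂)

mutual
  data _⊢[_]_∶_ : Env → ℕ → Term → Lin → Set where
    ax   : ∀ {x L} → single x L ⊢[ 0 ] var x ∶ L
    abs  : ∀ {Γ x M t L k c} → Γ x ≡ [] →
           (Γ , x ∶ M) ⊢[ k ] t ∶ L →
           Γ ⊢[ k ] lam c x t ∶ arr M c L
    ap   : ∀ {Γ Δ t u M L c d k₁ k₂} →
           Γ ⊢[ k₁ ] t ∶ arr M c L → Δ ⊢m[ k₂ ] u ∶ M →
           (Γ ⊕ Δ) ⊢[ cost c d k₁ k₂ ] app t d u ∶ L
    -- environments and types are taken modulo multiset equality
    conv : ∀ {Γ Γ' k t L L'} → Γ ≈E Γ' → L ≈L L' →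
           Γ ⊢[ k ] t ∶ L → Γ' ⊢[ k ] t ∶ L'

  data _⊢m[_]_∶_ : Env → ℕ → Term → Multi → Set where
    many[] : ∀ {t} → ∅ ⊢m[ 0 ] t ∶ []
    many∷  : ∀ {Γ Δ k₁ k₂ t L M} →
             Γ ⊢[ k₁ ] t ∶ L → Δ ⊢m[ k₂ ] t ∶ M →
             (Γ ⊕ Δ) ⊢m[ k₁ + k₂ ] t ∶ (L ∷ M)

data Pol : Set where
  pos negv : Pol

opp : Pol → Pol
opp pos = negv
opp negv = pos

mutual
  -- L' ≤^a_k L
  data LW : Pol → ℕ → Lin → Lin → Set where
    wvar  : ∀ {a X} → LW a 0 (tvar X) (tvar X)
    wflip : ∀ {k₁ k₂ M M' L L'} → MW negv k₁ M' M → LW pos k₂ L' L →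
            LW pos (suc (k₁ + k₂)) (arr M' ∘ L') (arr M ● L)
    warr  : ∀ {a c k₁ k₂ M M' L L'} → MW (opp a) k₁ M' M → LW a k₂ L' L →
            LW a (k₁ + k₂) (arr M' c L') (arr M c L)

  -- [L'_1..L'_n] ≤^a_{Σ k_i} [L_1..L_n]  with L'_i ≤^a_{k_i} L_i
  -- (pairing up to reordering of the multiset)
  data MW : Pol → ℕ → Multi → Multi → Set where
    wnil  : ∀ {a} → MW a 0 [] []
    wcons : ∀ {a k₁ k₂ L' L M' xs ys} → LW a k₁ L' L → MW a k₂ M' (xs ++ ys) →
            MW a (k₁ + k₂) (L' ∷ M') (xs ++ L ∷ ys)

EWUpTo : Pol → ℕ → ℕ → Env → Env → Set
EWUpTo a zero    k Γ' Γ = k ≡ 0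
EWUpTo a (suc n) k Γ' Γ =
  ∃[ k₁ ] ∃[ k₂ ] (k ≡ k₁ + k₂ × MW a k₁ (Γ' n) (Γ n) × EWUpTo a n k₂ Γ' Γ)

EW : Pol → ℕ → Env → Env → Set
EW a k Γ' Γ = ∃[ n ] ((∀ x → n ≤ x → Γ' x ≡ [] × Γ x ≡ []) × EWUpTo a n k Γ' Γ)

PW : Pol → ℕ → (Env × Lin) → (Env × Lin) → Set
PW a k (Γ' , L') (Γ , L) =
  ∃[ k₁ ] ∃[ k₂ ] (k ≡ k₁ + k₂ × EW (opp a) k₁ Γ' Γ × LW a k₂ L' L)

{-# OPTIONS --safe #-}
-- By induction on t: given whitenings of total weight i, we retype t with whitenings of total weight
-- j such that k + j ≤ k' + i and k' + j ≤ k + i, a form that adds up along derivations and composes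
-- along chains of retypings. A variable is retyped at the meet of its whitened context entry and the
-- whitened target. An abstraction passes the whitening of its domain to the context and reads it back
-- off the retyped body. An application retypes the function, then the argument against the
-- (negatively whitened) domain of the new function type, and repeats while the argument type keeps
-- getting whiter; each round whitens a black arrow, so this terminates. The counter changes only at
-- applications, by the mismatch between the colour of the function arrow and that of the
-- application, and whitening that arrow changes the mismatch by at most its weight.
module Submission where

open import Defs
open import Data.Nat using (ℕ; zero; suc; _+_; _∸_; _≤_; _<_; _⊔_; ∣_-_∣; z≤n; s≤s; s≤s⁻¹; z<s; _≟_; _<?_)
open import Data.Nat.Properties
open import Data.Nat.Tactic.RingSolver using (solve)
open import Algebra.Properties.CommutativeSemigroup +-commutativeSemigroup
  using (interchange; x∙yz≈y∙xz; xy∙z≈zy∙x)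
open import Data.List using (List; []; _∷_; _++_)
open import Data.List.Properties using (++-assoc; ++-conicalˡ; ++-conicalʳ; ∷-injectiveˡ; ∷-injectiveʳ)
open import Data.Product using (Σ; _×_; _,_; proj₁; proj₂; ∃-syntax)
open import Data.Sum using (_⊎_; inj₁; inj₂)
open import Data.Empty using (⊥-elim)
open import Relation.Nullary using (yes; no)
open import Relation.Binary.PropositionalEquality

private variable
  A : Set
  a : Pol
  c d : Col
  i j k l : ℕ

++≡++∷-inv : ∀ (p q r : List A) b s → p ++ q ≡ r ++ b ∷ s →
  (∃[ u ] (p ≡ r ++ b ∷ u × s ≡ u ++ q)) ⊎ (∃[ u ] (r ≡ p ++ u × q ≡ u ++ b ∷ s))
++≡++∷-inv []      q r       b s eq = inj₂ (r , refl , eq)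
++≡++∷-inv (x ∷ p) q []      b s eq = inj₁ (p , cong (_∷ p) (∷-injectiveˡ eq) , sym (∷-injectiveʳ eq))
++≡++∷-inv (x ∷ p) q (y ∷ r) b s eq with ++≡++∷-inv p q r b s (∷-injectiveʳ eq)
... | inj₁ (u , p≡ , s≡) = inj₁ (u , cong₂ _∷_ (∷-injectiveˡ eq) p≡ , s≡)
... | inj₂ (u , r≡ , q≡) = inj₂ (u , cong₂ _∷_ (sym (∷-injectiveˡ eq)) r≡ , q≡)

++∷≡++∷-inv : ∀ (p q r s : List A) a b → p ++ a ∷ q ≡ r ++ b ∷ s →
  (p ≡ r × a ≡ b × q ≡ s)
  ⊎ (∃[ u ] (r ≡ p ++ a ∷ u × q ≡ u ++ b ∷ s))
  ⊎ (∃[ u ] (p ≡ r ++ b ∷ u × s ≡ u ++ a ∷ q))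
++∷≡++∷-inv []      q []      s a b eq = inj₁ (refl , ∷-injectiveˡ eq , ∷-injectiveʳ eq)
++∷≡++∷-inv []      q (y ∷ r) s a b eq =
  inj₂ (inj₁ (r , cong (_∷ r) (sym (∷-injectiveˡ eq)) , ∷-injectiveʳ eq))
++∷≡++∷-inv (x ∷ p) q []      s a b eq =
  inj₂ (inj₂ (p , cong (_∷ p) (∷-injectiveˡ eq) , sym (∷-injectiveʳ eq)))
++∷≡++∷-inv (x ∷ p) q (y ∷ r) s a b eq with ++∷≡++∷-inv p q r s a b (∷-injectiveʳ eq)
... | inj₁ (p≡ , a≡ , q≡)        = inj₁ (cong₂ _∷_ (∷-injectiveˡ eq) p≡ , a≡ , q≡)
... | inj₂ (inj₁ (u , r≡ , q≡)) = inj₂ (inj₁ (u , cong₂ _∷_ (sym (∷-injectiveˡ eq)) r≡ , q≡))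
... | inj₂ (inj₂ (u , p≡ , s≡)) = inj₂ (inj₂ (u , cong₂ _∷_ (∷-injectiveˡ eq) p≡ , s≡))

mutual
  ≈L-refl : ∀ L → L ≈L L
  ≈L-refl (tvar X)    = ≈tvar
  ≈L-refl (arr M c L) = ≈arr (≈M-refl M) (≈L-refl L)

  ≈M-refl : ∀ M → M ≈M M
  ≈M-refl []      = ≈nil
  ≈M-refl (L ∷ M) = ≈cons {xs = []} (≈L-refl L) (≈M-refl M)

≈M-reflexive : ∀ {M N} → M ≡ N → M ≈M N
≈M-reflexive {M} refl = ≈M-refl M

≈M-insert : ∀ xs {ys M L L'} → (xs ++ ys) ≈M M → L ≈L L' → (xs ++ L ∷ ys) ≈M (L' ∷ M)
≈M-insert []       xs≈ L≈ = ≈cons {xs = []} L≈ xs≈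
≈M-insert (x ∷ xs) {L' = L'} (≈cons {xs = p} {ys = q} x≈ xs≈) L≈ =
  ≈cons {xs = L' ∷ p} {ys = q} x≈ (≈M-insert xs xs≈ L≈)

mutual
  ≈L-sym : ∀ {L L'} → L ≈L L' → L' ≈L L
  ≈L-sym ≈tvar        = ≈tvar
  ≈L-sym (≈arr M≈ L≈) = ≈arr (≈M-sym M≈) (≈L-sym L≈)

  ≈M-sym : ∀ {M M'} → M ≈M M' → M' ≈M M
  ≈M-sym ≈nil                    = ≈nil
  ≈M-sym (≈cons {xs = xs} L≈ M≈) = ≈M-insert xs (≈M-sym M≈) (≈L-sym L≈)

≈E-sym : ∀ {Γ Δ} → Γ ≈E Δ → Δ ≈E Γ
≈E-sym Γ≈Δ x = ≈M-sym (Γ≈Δ x)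

≈M-[] : ∀ {M M'} → M ≈M M' → M ≡ [] → M' ≡ []
≈M-[] ≈nil refl = refl

≈M-extract : ∀ xs {L ys M} → (xs ++ L ∷ ys) ≈M M →
  ∃[ p ] ∃[ L' ] ∃[ q ] (M ≡ p ++ L' ∷ q × L ≈L L' × (xs ++ ys) ≈M (p ++ q))
≈M-extract [] (≈cons {xs = p} {ys = q} L≈ M≈) = p , _ , q , refl , L≈ , M≈
≈M-extract (x ∷ xs) (≈cons {L' = x'} {xs = P} {ys = Q} x≈ M≈) with ≈M-extract xs M≈
... | p , L' , q , eq , L≈ , rest≈ with ++≡++∷-inv P Q p L' q eq
...   | inj₁ (u , refl , refl) =
  p , L' , u ++ x' ∷ Q , ++-assoc p (L' ∷ u) (x' ∷ Q) , L≈ ,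
  subst (_ ≈M_) (++-assoc p u (x' ∷ Q))
    (≈cons {xs = p ++ u} {ys = Q} x≈ (subst (_ ≈M_) (sym (++-assoc p u Q)) rest≈))
...   | inj₂ (u , refl , refl) =
  P ++ x' ∷ u , L' , q , sym (++-assoc P (x' ∷ u) (L' ∷ q)) , L≈ ,
  subst (_ ≈M_) (sym (++-assoc P (x' ∷ u) q))
    (≈cons {xs = P} {ys = u ++ q} x≈ (subst (_ ≈M_) (++-assoc P u q) rest≈))

MW-cast : ∀ {M₁ M₂ N₁ N₂} → k ≡ l → M₁ ≡ M₂ → N₁ ≡ N₂ → MW a k M₁ N₁ → MW a l M₂ N₂
MW-cast refl refl refl w = w

LW-cast : ∀ {L' L} → k ≡ l → LW a k L' L → LW a l L' L
LW-cast refl w = w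

mutual
  LW-refl : ∀ L → LW a 0 L L
  LW-refl (tvar X)    = wvar
  LW-refl (arr M c L) = warr (MW-refl M) (LW-refl L)

  MW-refl : ∀ M → MW a 0 M M
  MW-refl []      = wnil
  MW-refl (L ∷ M) = wcons {xs = []} (LW-refl L) (MW-refl M)

MW-[]ʳ : ∀ {M' M} → MW a k M' M → M ≡ [] → M' ≡ [] × k ≡ 0
MW-[]ʳ wnil                     refl = refl , refl
MW-[]ʳ (wcons {xs = []} _ _)    ()
MW-[]ʳ (wcons {xs = _ ∷ _} _ _) ()

mutual
  LW-resp-≈ : ∀ {L' L N} → LW a k L' L → L ≈L N → LW a k L' N
  LW-resp-≈ wvar        ≈tvar        = wvar
  LW-resp-≈ (wflip m l) (≈arr M≈ L≈) = wflip (MW-resp-≈ m M≈) (LW-resp-≈ l L≈)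
  LW-resp-≈ (warr m l)  (≈arr M≈ L≈) = warr (MW-resp-≈ m M≈) (LW-resp-≈ l L≈)

  MW-resp-≈ : ∀ {M' M N} → MW a k M' M → M ≈M N → MW a k M' N
  MW-resp-≈ wnil ≈nil = wnil
  MW-resp-≈ (wcons {xs = xs} l m) M≈ with ≈M-extract xs M≈
  ... | _ , _ , _ , refl , L≈ , rest≈ = wcons (LW-resp-≈ l L≈) (MW-resp-≈ m rest≈)

mutual
  LW-0⇒≈L : ∀ {L' L} → LW a k L' L → k ≡ 0 → L' ≈L L
  LW-0⇒≈L wvar                 _   = ≈tvar
  LW-0⇒≈L (warr {k₁ = k₁} m l) k≡0 =
    ≈arr (MW-0⇒≈M m (m+n≡0⇒m≡0 k₁ k≡0)) (LW-0⇒≈L l (m+n≡0⇒n≡0 k₁ k≡0))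

  MW-0⇒≈M : ∀ {M' M} → MW a k M' M → k ≡ 0 → M' ≈M M
  MW-0⇒≈M wnil                  _   = ≈nil
  MW-0⇒≈M (wcons {k₁ = k₁} l m) k≡0 =
    ≈cons (LW-0⇒≈L l (m+n≡0⇒m≡0 k₁ k≡0)) (MW-0⇒≈M m (m+n≡0⇒n≡0 k₁ k≡0))

MW-extractˡ : ∀ xs {L' ys M} → MW a k (xs ++ L' ∷ ys) M →
  ∃[ p ] ∃[ L ] ∃[ q ] ∃[ k₁ ] ∃[ k₂ ]
    (M ≡ p ++ L ∷ q × LW a k₁ L' L × MW a k₂ (xs ++ ys) (p ++ q) × k ≡ k₁ + k₂)
MW-extractˡ [] (wcons {xs = p} {ys = q} l m) = p , _ , q , _ , _ , refl , l , m , refl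
MW-extractˡ (x ∷ xs) (wcons {k₁ = kx} {L = y} {xs = P} {ys = Q} x≤y m) with MW-extractˡ xs m
... | p , L , q , k₁ , k₂ , eq , l , rest , refl with ++≡++∷-inv P Q p L q eq
...   | inj₁ (u , refl , refl) =
  p , L , u ++ y ∷ Q , k₁ , kx + k₂ , ++-assoc p (L ∷ u) (y ∷ Q) , l ,
  MW-cast refl refl (++-assoc p u (y ∷ Q))
    (wcons {xs = p ++ u} {ys = Q} x≤y (MW-cast refl refl (sym (++-assoc p u Q)) rest)) ,
  x∙yz≈y∙xz kx k₁ k₂
...   | inj₂ (u , refl , refl) =
  P ++ y ∷ u , L , q , k₁ , kx + k₂ , sym (++-assoc P (y ∷ u) (L ∷ q)) , l ,
  MW-cast refl refl (sym (++-assoc P (y ∷ u) q))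
    (wcons {xs = P} {ys = u ++ q} x≤y (MW-cast refl refl (++-assoc P u q) rest)) ,
  x∙yz≈y∙xz kx k₁ k₂

MW-extractʳ : ∀ xs {L ys M' M} → MW a k M' M → M ≡ xs ++ L ∷ ys →
  ∃[ p ] ∃[ L' ] ∃[ q ] ∃[ k₁ ] ∃[ k₂ ]
    (M' ≡ p ++ L' ∷ q × LW a k₁ L' L × MW a k₂ (p ++ q) (xs ++ ys) × k ≡ k₁ + k₂)
MW-extractʳ [] wnil ()
MW-extractʳ (_ ∷ _) wnil ()
MW-extractʳ xs {L} {ys} (wcons {k₁ = k₀} {k₂ = k₂} {L' = y'} {L = y} {M' = M'} {xs = P} {ys = Q} l m) eq
  with ++∷≡++∷-inv P Q xs ys y L eq
... | inj₁ (refl , refl , refl) = [] , y' , M' , k₀ , k₂ , refl , l , m , refl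
... | inj₂ (inj₁ (u , refl , refl)) with MW-extractʳ (P ++ u) m (sym (++-assoc P u (L ∷ ys)))
...   | p , L' , q , k₁ , k₃ , refl , l' , rest , refl =
  y' ∷ p , L' , q , k₁ , k₀ + k₃ , refl , l' ,
  MW-cast refl refl (sym (++-assoc P (y ∷ u) ys))
    (wcons {xs = P} {ys = u ++ ys} l (MW-cast refl refl (++-assoc P u ys) rest)) ,
  x∙yz≈y∙xz k₀ k₁ k₃
MW-extractʳ xs {L} {ys} (wcons {k₁ = k₀} {k₂ = k₂} {L' = y'} {L = y} {xs = P} {ys = Q} l m) eq
    | inj₂ (inj₂ (u , refl , refl)) with MW-extractʳ xs m (++-assoc xs (L ∷ u) Q)
...   | p , L' , q , k₁ , k₃ , refl , l' , rest , refl =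
  y' ∷ p , L' , q , k₁ , k₀ + k₃ , refl , l' ,
  MW-cast refl refl (++-assoc xs u (y ∷ Q))
    (wcons {xs = xs ++ u} {ys = Q} l (MW-cast refl refl (sym (++-assoc xs u Q)) rest)) ,
  x∙yz≈y∙xz k₀ k₁ k₃

MW-[-]ʳ : ∀ {M' L} → MW a k M' (L ∷ []) → ∃[ L' ] (M' ≡ L' ∷ [] × LW a k L' L)
MW-[-]ʳ w with MW-extractʳ [] w refl
... | p , L' , q , k₁ , k₂ , refl , l , rest , refl with MW-[]ʳ rest refl
... | p++q≡[] , refl rewrite ++-conicalˡ p q p++q≡[] | ++-conicalʳ p q p++q≡[] =
  L' , refl , LW-cast (sym (+-identityʳ k₁)) l

record MW-Split (a : Pol) (k : ℕ) (M' P Q : Multi) : Set where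
  constructor mw-split
  field
    {P' Q'}  : Multi
    {k₁ k₂}  : ℕ
    k≡       : k ≡ k₁ + k₂
    P'≤P     : MW a k₁ P' P
    Q'≤Q     : MW a k₂ Q' Q
    P'++Q'≈  : (P' ++ Q') ≈M M'

MW-split-++ : ∀ {M' N} P Q → MW a k M' N → N ≡ P ++ Q → MW-Split a k M' P Q
MW-split-++ P Q wnil eq with ++-conicalˡ P Q (sym eq) | ++-conicalʳ P Q (sym eq)
... | refl | refl = mw-split refl wnil wnil ≈nil
MW-split-++ P Q (wcons {k₁ = k₀} {L' = y'} {L = y} {xs = xs} {ys = ys} l m) eq
  with ++≡++∷-inv P Q xs y ys (sym eq)
... | inj₁ (u , refl , refl) with MW-split-++ (xs ++ u) Q m (sym (++-assoc xs u Q))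
...   | mw-split {k₁ = k₁} {k₂} refl m₁ m₂ M≈ =
  mw-split (sym (+-assoc k₀ k₁ k₂)) (wcons {xs = xs} {ys = u} l m₁) m₂ (≈cons {xs = []} (≈L-refl y') M≈)
MW-split-++ P Q (wcons {k₁ = k₀} {L' = y'} {L = y} {xs = xs} {ys = ys} l m) eq
    | inj₂ (u , refl , refl) with MW-split-++ P (u ++ ys) m (++-assoc P u ys)
...   | mw-split {P' = M₁} {k₁ = k₁} {k₂} refl m₁ m₂ M≈ =
  mw-split (x∙yz≈y∙xz k₀ k₁ k₂) m₁ (wcons {xs = u} {ys = ys} l m₂) (≈M-insert M₁ M≈ (≈L-refl y'))

MW-++ : ∀ {M₁' M₁ M₂' M₂} → MW a k M₁' M₁ → MW a l M₂' M₂ → MW a (k + l) (M₁' ++ M₂') (M₁ ++ M₂)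
MW-++ wnil m₂ = m₂
MW-++ {l = l} {M₂ = M₂} (wcons {k₁ = k₀} {k₂ = k₁} {L = L} {xs = xs} {ys = ys} x≤L m₁) m₂ =
  MW-cast (sym (+-assoc k₀ k₁ l)) refl (sym (++-assoc xs (L ∷ ys) M₂))
    (wcons {xs = xs} {ys = ys ++ M₂} x≤L (MW-cast refl refl (++-assoc xs ys M₂) (MW-++ m₁ m₂)))

mutual
  LW-trans : ∀ {L₁ L₂ L₃} → LW a k L₁ L₂ → LW a l L₂ L₃ → LW a (k + l) L₁ L₃
  LW-trans wvar wvar = wvar
  LW-trans (wflip {k₁ = a₁} {k₂ = a₂} m l) (warr {k₁ = b₁} {k₂ = b₂} m' l') =
    LW-cast (cong suc (interchange a₁ b₁ a₂ b₂)) (wflip (MW-trans m m') (LW-trans l l'))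
  LW-trans (warr {k₁ = a₁} {k₂ = a₂} m l) (wflip {k₁ = b₁} {k₂ = b₂} m' l') =
    LW-cast (trans (cong suc (interchange a₁ b₁ a₂ b₂)) (sym (+-suc (a₁ + a₂) (b₁ + b₂))))
      (wflip (MW-trans m m') (LW-trans l l'))
  LW-trans (warr {k₁ = a₁} {k₂ = a₂} m l) (warr {k₁ = b₁} {k₂ = b₂} m' l') =
    LW-cast (interchange a₁ b₁ a₂ b₂) (warr (MW-trans m m') (LW-trans l l'))

  MW-trans : ∀ {M₁ M₂ M₃} → MW a k M₁ M₂ → MW a l M₂ M₃ → MW a (k + l) M₁ M₃
  MW-trans wnil wnil = wnil
  MW-trans (wcons {k₁ = a₁} {k₂ = a₂} {xs = xs} x≤y m) m' with MW-extractˡ xs m'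
  ... | _ , _ , _ , b₁ , b₂ , refl , y≤z , rest , refl =
    MW-cast (interchange a₁ b₁ a₂ b₂) refl refl (wcons (LW-trans x≤y y≤z) (MW-trans m rest))

mutual
  LW-meet : ∀ a {L₁ L₂ L} → LW a i L₁ L → LW (opp a) j L₂ L → ∃[ W ] (LW (opp a) j W L₁ × LW a i W L₂)
  LW-meet pos wvar wvar = _ , wvar , wvar
  LW-meet pos (wflip m₁ l₁) (warr m₂ l₂) with MW-meet negv m₁ m₂ | LW-meet pos l₁ l₂
  ... | M , M≤₁ , M≤₂ | L , L≤₁ , L≤₂ = arr M ∘ L , warr M≤₁ L≤₁ , wflip M≤₂ L≤₂
  LW-meet pos (warr m₁ l₁) (warr m₂ l₂) with MW-meet negv m₁ m₂ | LW-meet pos l₁ l₂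
  ... | M , M≤₁ , M≤₂ | L , L≤₁ , L≤₂ = arr M _ L , warr M≤₁ L≤₁ , warr M≤₂ L≤₂
  LW-meet negv wvar wvar = _ , wvar , wvar
  LW-meet negv (warr m₁ l₁) (warr m₂ l₂) with MW-meet pos m₁ m₂ | LW-meet negv l₁ l₂
  ... | M , M≤₁ , M≤₂ | L , L≤₁ , L≤₂ = arr M _ L , warr M≤₁ L≤₁ , warr M≤₂ L≤₂
  LW-meet negv (warr m₁ l₁) (wflip m₂ l₂) with MW-meet pos m₁ m₂ | LW-meet negv l₁ l₂
  ... | M , M≤₁ , M≤₂ | L , L≤₁ , L≤₂ = arr M ∘ L , wflip M≤₁ L≤₁ , warr M≤₂ L≤₂

  MW-meet : ∀ a {M₁ M₂ M} → MW a i M₁ M → MW (opp a) j M₂ M → ∃[ W ] (MW (opp a) j W M₁ × MW a i W M₂)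
  MW-meet a wnil m₂ with MW-[]ʳ m₂ refl
  ... | refl , refl = [] , wnil , wnil
  MW-meet a (wcons {xs = xs} l₁ m₁) m₂ with MW-extractʳ xs m₂ refl
  ... | p , _ , q , _ , _ , refl , l₂ , rest , refl with MW-meet a m₁ rest | LW-meet a l₁ l₂
  ... | W , W≤₁ , W≤₂ | L , L≤₁ , L≤₂ = L ∷ W , wcons {xs = []} L≤₁ W≤₁ , wcons {xs = p} {ys = q} L≤₂ W≤₂

black : Col → ℕ
black ∘ = 0
black ● = 1

mutual
  blacks : Lin → ℕ
  blacks (tvar _)    = 0
  blacks (arr M c L) = black c + (blacksᴹ M + blacks L)

  blacksᴹ : Multi → ℕ
  blacksᴹ []      = 0
  blacksᴹ (L ∷ M) = blacks L + blacksᴹ M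

blacksᴹ-++ : ∀ M N → blacksᴹ (M ++ N) ≡ blacksᴹ M + blacksᴹ N
blacksᴹ-++ []      N = refl
blacksᴹ-++ (L ∷ M) N = trans (cong (blacks L +_) (blacksᴹ-++ M N)) (sym (+-assoc (blacks L) _ _))

+-interchange-≡ : ∀ m' l' k₁ k₂ {m l} → m' + k₁ ≡ m → l' + k₂ ≡ l → (m' + l') + (k₁ + k₂) ≡ m + l
+-interchange-≡ m' l' k₁ k₂ refl refl = interchange m' l' k₁ k₂

mutual
  LW-blacks : ∀ {L' L} → LW a k L' L → blacks L' + k ≡ blacks L
  LW-blacks wvar = refl
  LW-blacks (wflip {k₁ = k₁} {k₂} {M' = M'} {L' = L'} m l) = trans (+-suc _ (k₁ + k₂))
    (cong suc (+-interchange-≡ (blacksᴹ M') (blacks L') k₁ k₂ (MW-blacks m) (LW-blacks l)))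
  LW-blacks (warr {c = c} {k₁} {k₂} {M' = M'} {L' = L'} m l) =
    trans (+-assoc (black c) _ _)
      (cong (black c +_) (+-interchange-≡ (blacksᴹ M') (blacks L') k₁ k₂ (MW-blacks m) (LW-blacks l)))

  MW-blacks : ∀ {M' M} → MW a k M' M → blacksᴹ M' + k ≡ blacksᴹ M
  MW-blacks wnil = refl
  MW-blacks (wcons {k₁ = k₁} {k₂} {L' = L'} {L = L} {M' = M'} {xs = xs} {ys = ys} l m) = begin
    (blacks L' + blacksᴹ M') + (k₁ + k₂) ≡⟨ +-interchange-≡ (blacks L') _ k₁ k₂ (LW-blacks l) (MW-blacks m) ⟩
    blacks L + blacksᴹ (xs ++ ys)        ≡⟨ cong (blacks L +_) (blacksᴹ-++ xs ys) ⟩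
    blacks L + (blacksᴹ xs + blacksᴹ ys) ≡⟨ x∙yz≈y∙xz (blacks L) (blacksᴹ xs) _ ⟩
    blacksᴹ xs + (blacks L + blacksᴹ ys) ≡⟨ blacksᴹ-++ xs (L ∷ ys) ⟨
    blacksᴹ (xs ++ L ∷ ys)               ∎
    where open ≡-Reasoning

MW-blacks-≤ : ∀ {M' M} → MW a k M' M → blacksᴹ M' ≤ blacksᴹ M
MW-blacks-≤ {k = k} w = subst (_ ≤_) (MW-blacks w) (m≤m+n _ k)

MW-blacks-< : ∀ {M' M} → MW a (suc k) M' M → blacksᴹ M' < blacksᴹ M
MW-blacks-< w = subst (_ <_) (MW-blacks w) (m<m+n _ z<s)

data CW : ℕ → Col → Col → Set where
  cw-refl : CW 0 c c
  cw-flip : CW 1 ∘ ●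

CW-trans : ∀ {c₁ c₂ c₃} → CW k c₁ c₂ → CW l c₂ c₃ → CW (k + l) c₁ c₃
CW-trans cw-refl w       = w
CW-trans cw-flip cw-refl = cw-flip

data LW⁺-Arr : ℕ → Lin → Multi → Col → Lin → Set where
  lw⁺-arr : ∀ {δ m l M' M c' c L' L} → CW δ c' c → MW negv m M' M → LW pos l L' L →
            LW⁺-Arr (δ + (m + l)) (arr M' c' L') M c L

LW⁺-arr-inv : ∀ {T M L} → LW pos j T (arr M c L) → LW⁺-Arr j T M c L
LW⁺-arr-inv (wflip m l) = lw⁺-arr cw-flip m l
LW⁺-arr-inv (warr m l)  = lw⁺-arr cw-refl m l

-- Balanced k k' I J encodes  J ≤ I  and  ∣ k - k' ∣ ≤ I ∸ J  without truncated subtraction.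
record Balanced (k k' I J : ℕ) : Set where
  constructor balanced
  field
    ≤ˡ : k + J ≤ k' + I
    ≤ʳ : k' + J ≤ k + I

balanced-resp : ∀ {k k' I I' J J'} → Balanced k k' I J → I ≡ I' → J ≡ J' → Balanced k k' I' J'
balanced-resp b refl refl = b

balanced-≤ : ∀ {I J} → J ≤ I → Balanced k k I J
balanced-≤ {k} J≤I = balanced (+-monoʳ-≤ k J≤I) (+-monoʳ-≤ k J≤I)

balanced-+ : ∀ {k₁ k₁' I₁ J₁ k₂ k₂' I₂ J₂} → Balanced k₁ k₁' I₁ J₁ → Balanced k₂ k₂' I₂ J₂ →
  Balanced (k₁ + k₂) (k₁' + k₂') (I₁ + I₂) (J₁ + J₂)
balanced-+ {k₁} {k₁'} {I₁} {J₁} {k₂} {k₂'} {I₂} {J₂} (balanced p₁ q₁) (balanced p₂ q₂) = balanced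
  (subst₂ _≤_ (interchange k₁ J₁ k₂ J₂) (interchange k₁' I₁ k₂' I₂) (+-mono-≤ p₁ p₂))
  (subst₂ _≤_ (interchange k₁' J₁ k₂' J₂) (interchange k₁ I₁ k₂ I₂) (+-mono-≤ q₁ q₂))

balanced-trans : ∀ {k₁ k₂ k₃ I₁ J₁ I₂ J₂} → Balanced k₁ k₂ I₁ J₁ → Balanced k₂ k₃ I₂ J₂ →
  Balanced k₁ k₃ (I₁ + I₂) (J₁ + J₂)
balanced-trans {k₁} {k₂} {k₃} {I₁} {J₁} {I₂} {J₂} (balanced p₁ q₁) (balanced p₂ q₂) = balanced
  (chain k₁ k₂ k₃ I₁ J₁ I₂ J₂ p₁ p₂)
  (subst₂ (λ J I → k₃ + J ≤ k₁ + I) (+-comm J₂ J₁) (+-comm I₂ I₁) (chain k₃ k₂ k₁ I₂ J₂ I₁ J₁ q₂ q₁))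
  where
    chain : ∀ a b c i j i' j' → a + j ≤ b + i → b + j' ≤ c + i' → a + (j + j') ≤ c + (i + i')
    chain a b c i j i' j' p q = +-cancelˡ-≤ b _ _ (begin
      b + (a + (j + j'))  ≡⟨ solve (a ∷ b ∷ j ∷ j' ∷ []) ⟩
      (a + j) + (b + j')  ≤⟨ +-mono-≤ p q ⟩
      (b + i) + (c + i')  ≡⟨ solve (b ∷ c ∷ i ∷ i' ∷ []) ⟩
      b + (c + (i + i'))  ∎)
      where open ≤-Reasoning

balanced-cancel : ∀ {k k' I J} m → Balanced k k' (I + m) (J + m) → Balanced k k' I J
balanced-cancel {k} {k'} {I} {J} m (balanced p q) = balanced (cancel p) (cancel q)
  where
    cancel : ∀ {a b} → a + (J + m) ≤ b + (I + m) → a + J ≤ b + I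
    cancel {a} {b} le = +-cancelʳ-≤ m _ _ (subst₂ _≤_ (sym (+-assoc a J m)) (sym (+-assoc b I m)) le)

mismatch : Col → Col → ℕ
mismatch ∘ ∘ = 0
mismatch ● ● = 0
mismatch ∘ ● = 1
mismatch ● ∘ = 1

cost≡mismatch+ : ∀ c d k₁ k₂ → cost c d k₁ k₂ ≡ mismatch c d + (k₁ + k₂)
cost≡mismatch+ ∘ ∘ k₁ k₂ = refl
cost≡mismatch+ ● ● k₁ k₂ = refl
cost≡mismatch+ ∘ ● k₁ k₂ = refl
cost≡mismatch+ ● ∘ k₁ k₂ = refl

mismatch-balanced : ∀ {c' c} d → CW k c' c → Balanced (mismatch c d) (mismatch c' d) k 0
mismatch-balanced d cw-refl = balanced-≤ z≤n
mismatch-balanced ∘ cw-flip = balanced (s≤s z≤n) z≤n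
mismatch-balanced ● cw-flip = balanced z≤n (s≤s z≤n)

cost-balanced : ∀ {c' c k₁ k₂ k₁' k₂' I J} d → CW l c' c → Balanced (k₁ + k₂) (k₁' + k₂') I (J + l) →
  Balanced (cost c d k₁ k₂) (cost c' d k₁' k₂') I J
cost-balanced {l} {c'} {c} {k₁} {k₂} {k₁'} {k₂'} {I} d cw b
  rewrite cost≡mismatch+ c d k₁ k₂ | cost≡mismatch+ c' d k₁' k₂' =
  balanced-cancel l (balanced-resp (balanced-+ (mismatch-balanced d cw) b) (+-comm l I) refl)

n+j≤m+i⇒j≤i×n∸m≤i∸j : ∀ {m n i j} → m ≤ n → n + j ≤ m + i → j ≤ i × n ∸ m ≤ i ∸ j
n+j≤m+i⇒j≤i×n∸m≤i∸j {m} {n} {i} {j} m≤n le = ≤-trans (m≤n+m j (n ∸ m)) gap+j≤i , m+n≤o⇒m≤o∸n (n ∸ m) gap+j≤i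
  where
    gap+j≤i : (n ∸ m) + j ≤ i
    gap+j≤i = +-cancelˡ-≤ m _ _ (begin
      m + ((n ∸ m) + j) ≡⟨ sym (+-assoc m (n ∸ m) j) ⟩
      (m + (n ∸ m)) + j ≡⟨ cong (_+ j) (m+[n∸m]≡n m≤n) ⟩
      n + j             ≤⟨ le ⟩
      m + i             ∎)
      where open ≤-Reasoning

balanced⇒∣-∣≤∸ : ∀ {k k' I J} → Balanced k k' I J → J ≤ I × ∣ k - k' ∣ ≤ I ∸ J
balanced⇒∣-∣≤∸ {k} {k'} (balanced p q) with ≤-total k k'
... | inj₁ k≤k' rewrite m≤n⇒∣m-n∣≡n∸m k≤k' = n+j≤m+i⇒j≤i×n∸m≤i∸j k≤k' q
... | inj₂ k'≤k rewrite m≤n⇒∣n-m∣≡n∸m k'≤k = n+j≤m+i⇒j≤i×n∸m≤i∸j k'≤k p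

sumBelow : ℕ → (ℕ → ℕ) → ℕ
sumBelow zero    f = 0
sumBelow (suc n) f = f n + sumBelow n f

module _ {f g : ℕ → ℕ} where

  sumBelow-cong : ∀ n → (∀ x → x < n → f x ≡ g x) → sumBelow n f ≡ sumBelow n g
  sumBelow-cong zero    f≡g = refl
  sumBelow-cong (suc n) f≡g = cong₂ _+_ (f≡g n ≤-refl) (sumBelow-cong n (λ x x<n → f≡g x (m≤n⇒m≤1+n x<n)))

  sumBelow-+ : ∀ n → sumBelow n (λ x → f x + g x) ≡ sumBelow n f + sumBelow n g
  sumBelow-+ zero    = refl
  sumBelow-+ (suc n) = trans (cong (f n + g n +_) (sumBelow-+ n)) (interchange (f n) (g n) _ _)

sumBelow-0 : ∀ n {f} → (∀ x → x < n → f x ≡ 0) → sumBelow n f ≡ 0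
sumBelow-0 zero    f≡0 = refl
sumBelow-0 (suc n) f≡0 = cong₂ _+_ (f≡0 n ≤-refl) (sumBelow-0 n (λ x x<n → f≡0 x (m≤n⇒m≤1+n x<n)))

sumBelow-extend : ∀ {n f} N → (∀ x → n ≤ x → f x ≡ 0) → n ≤ N → sumBelow N f ≡ sumBelow n f
sumBelow-extend zero    f≡0 z≤n = refl
sumBelow-extend (suc N) f≡0 n≤1+N with m≤n⇒m<n∨m≡n n≤1+N
... | inj₁ (s≤s n≤N) = cong₂ _+_ (f≡0 N n≤N) (sumBelow-extend N f≡0 n≤N)
... | inj₂ refl      = refl

sumBelow-single : ∀ n {f x} → x < n → (∀ {y} → y ≢ x → f y ≡ 0) → sumBelow n f ≡ f x
sumBelow-single (suc n) {f} x<1+n f≡0 with m≤n⇒m<n∨m≡n x<1+n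
... | inj₁ (s≤s x<n) = cong₂ _+_ (f≡0 (>⇒≢ x<n)) (sumBelow-single n x<n f≡0)
... | inj₂ refl      = trans (cong (f n +_) (sumBelow-0 n (λ y y<n → f≡0 (<⇒≢ y<n)))) (+-identityʳ (f n))

update : (ℕ → A) → ℕ → A → ℕ → A
update f x v y with y ≟ x
... | yes _ = v
... | no  _ = f y

update-≡ : ∀ (f : ℕ → A) x v → update f x v x ≡ v
update-≡ f x v with x ≟ x
... | yes _   = refl
... | no  x≢x = ⊥-elim (x≢x refl)

update-≢ : ∀ (f : ℕ → A) x v {y} → y ≢ x → update f x v y ≡ f y
update-≢ f x v {y} y≢x with y ≟ x
... | yes y≡x = ⊥-elim (y≢x y≡x)
... | no  _   = refl

sumBelow-update : ∀ n {f x v} → x < n → sumBelow n (update f x v) + f x ≡ sumBelow n f + v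
sumBelow-update (suc n) {f} {x} {v} x<1+n with m≤n⇒m<n∨m≡n x<1+n
... | inj₁ (s≤s x<n) = begin
  (update f x v n + S′) + f x ≡⟨ cong (λ u → (u + S′) + f x) (update-≢ f x v (>⇒≢ x<n)) ⟩
  (f n + S′) + f x            ≡⟨ +-assoc (f n) S′ (f x) ⟩
  f n + (S′ + f x)            ≡⟨ cong (f n +_) (sumBelow-update n x<n) ⟩
  f n + (sumBelow n f + v)    ≡⟨ +-assoc (f n) _ v ⟨
  (f n + sumBelow n f) + v    ∎
  where
    open ≡-Reasoning
    S′ = sumBelow n (update f x v)
... | inj₂ refl = begin
  (update f n v n + sumBelow n (update f n v)) + f n ≡⟨ cong₂ (λ u w → u + w + f n) (update-≡ f n v) below ⟩
  (v + sumBelow n f) + f n                            ≡⟨ xy∙z≈zy∙x v _ (f n) ⟩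
  (f n + sumBelow n f) + v                            ∎
  where
    open ≡-Reasoning
    below : sumBelow n (update f n v) ≡ sumBelow n f
    below = sumBelow-cong n (λ y y<n → update-≢ f n v (<⇒≢ y<n))

,∶-≡ : ∀ Γ x M → (Γ , x ∶ M) x ≡ M
,∶-≡ Γ x M with x ≟ x
... | yes _   = refl
... | no  x≢x = ⊥-elim (x≢x refl)

,∶-≢ : ∀ Γ x M {y} → y ≢ x → (Γ , x ∶ M) y ≡ Γ y
,∶-≢ Γ x M {y} y≢x with y ≟ x
... | yes y≡x = ⊥-elim (y≢x y≡x)
... | no  _   = refl

,∶-restore : ∀ Γ x M y → ((Γ , x ∶ M) , x ∶ Γ x) y ≡ Γ y
,∶-restore Γ x M y with y ≟ x
... | yes refl = refl
... | no  y≢x  = ,∶-≢ Γ x M y≢x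

single-≡ : ∀ x L → single x L x ≡ L ∷ []
single-≡ x L with x ≟ x
... | yes _   = refl
... | no  x≢x = ⊥-elim (x≢x refl)

single-≢ : ∀ x L {y} → y ≢ x → single x L y ≡ []
single-≢ x L {y} y≢x with y ≟ x
... | yes y≡x = ⊥-elim (y≢x y≡x)
... | no  _   = refl

-- Unlike EW, which records whitenings only below its bound, EnvW keeps one for every variable,
-- so that environments can be split and updated pointwise.
record EnvW (a : Pol) (k : ℕ) (Γ' Γ : Env) : Set where
  constructor envW
  field
    bound     : ℕ
    weight    : ℕ → ℕ
    vanishes  : ∀ x → bound ≤ x → Γ x ≡ []
    pointwise : ∀ x → MW a (weight x) (Γ' x) (Γ x)
    total     : k ≡ sumBelow bound weight
open EnvW

module _ {Γ' Γ : Env} (e : EnvW a k Γ' Γ) where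

  weight-[] : ∀ x → Γ x ≡ [] → Γ' x ≡ [] × weight e x ≡ 0
  weight-[] x Γx≡[] = MW-[]ʳ (pointwise e x) Γx≡[]

  vanishesˡ : ∀ x → bound e ≤ x → Γ' x ≡ []
  vanishesˡ x bound≤x = proj₁ (weight-[] x (vanishes e x bound≤x))

  total-extend : ∀ N → bound e ≤ N → k ≡ sumBelow N (weight e)
  total-extend N bound≤N = trans (total e) (sym (sumBelow-extend N weight-vanishes bound≤N))
    where
      weight-vanishes : ∀ x → bound e ≤ x → weight e x ≡ 0
      weight-vanishes x bound≤x = proj₂ (weight-[] x (vanishes e x bound≤x))

EnvW-reflˡ : ∀ {b Γ' Γ} → EnvW a k Γ' Γ → EnvW b 0 Γ' Γ'
EnvW-reflˡ {Γ' = Γ'} e = record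
  { bound     = bound e
  ; weight    = λ _ → 0
  ; vanishes  = vanishesˡ e
  ; pointwise = λ x → MW-refl (Γ' x)
  ; total     = sym (sumBelow-0 (bound e) (λ _ _ → refl))
  }

EnvW-∅ : ∀ {b Γ'} → EnvW a k Γ' ∅ → EnvW b 0 ∅ Γ'
EnvW-∅ e = record
  { bound     = bound e
  ; weight    = λ _ → 0
  ; vanishes  = vanishesˡ e
  ; pointwise = λ x → MW-cast refl refl (sym (proj₁ (weight-[] e x refl))) wnil
  ; total     = sym (sumBelow-0 (bound e) (λ _ _ → refl))
  }

total-+ : ∀ {b c Γ₁' Γ₁ Γ₂' Γ₂} (e₁ : EnvW b k Γ₁' Γ₁) (e₂ : EnvW c l Γ₂' Γ₂) →
  k + l ≡ sumBelow (bound e₁ ⊔ bound e₂) (λ x → weight e₁ x + weight e₂ x)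
total-+ {k} {l} e₁ e₂ = begin
  k + l                                           ≡⟨ cong₂ _+_ (total-extend e₁ N (m≤m⊔n _ _))
                                                               (total-extend e₂ N (m≤n⊔m _ _)) ⟩
  sumBelow N (weight e₁) + sumBelow N (weight e₂) ≡⟨ sumBelow-+ N ⟨
  sumBelow N (λ x → weight e₁ x + weight e₂ x)    ∎
  where
    open ≡-Reasoning
    N = bound e₁ ⊔ bound e₂

EnvW-trans : ∀ {Γ₁ Γ₂ Γ₃} → EnvW a k Γ₁ Γ₂ → EnvW a l Γ₂ Γ₃ → EnvW a (k + l) Γ₁ Γ₃
EnvW-trans e₁ e₂ = record
  { bound     = bound e₁ ⊔ bound e₂
  ; weight    = λ x → weight e₁ x + weight e₂ x
  ; vanishes  = λ x N≤x → vanishes e₂ x (m⊔n≤o⇒n≤o _ _ N≤x)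
  ; pointwise = λ x → MW-trans (pointwise e₁ x) (pointwise e₂ x)
  ; total     = total-+ e₁ e₂
  }

EnvW-⊕ : ∀ {Γ' Γ Δ' Δ} → EnvW a k Γ' Γ → EnvW a l Δ' Δ → EnvW a (k + l) (Γ' ⊕ Δ') (Γ ⊕ Δ)
EnvW-⊕ e₁ e₂ = record
  { bound     = bound e₁ ⊔ bound e₂
  ; weight    = λ x → weight e₁ x + weight e₂ x
  ; vanishes  = λ x N≤x → cong₂ _++_ (vanishes e₁ x (m⊔n≤o⇒m≤o _ _ N≤x)) (vanishes e₂ x (m⊔n≤o⇒n≤o _ _ N≤x))
  ; pointwise = λ x → MW-++ (pointwise e₁ x) (pointwise e₂ x)
  ; total     = total-+ e₁ e₂
  }

EnvW-resp-≈ : ∀ {Γ' Γ Δ} → EnvW a k Γ' Γ → Γ ≈E Δ → EnvW a k Γ' Δ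
EnvW-resp-≈ e Γ≈Δ = record
  { bound     = bound e
  ; weight    = weight e
  ; vanishes  = λ x bound≤x → ≈M-[] (Γ≈Δ x) (vanishes e x bound≤x)
  ; pointwise = λ x → MW-resp-≈ (pointwise e x) (Γ≈Δ x)
  ; total     = total e
  }

EnvW-split-⊕ : ∀ {Γ'} Γ Δ → EnvW a k Γ' (Γ ⊕ Δ) →
  ∃[ Γ₁ ] ∃[ Δ₁ ] ∃[ k₁ ] ∃[ k₂ ] (k ≡ k₁ + k₂ × EnvW a k₁ Γ₁ Γ × EnvW a k₂ Δ₁ Δ × (Γ₁ ⊕ Δ₁) ≈E Γ')
EnvW-split-⊕ {a} {k} {Γ'} Γ Δ e =
  (λ x → P' (S x)) , (λ x → Q' (S x)) , _ , _ , k-split ,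
  envW (bound e) (λ x → k₁ (S x)) Γ-vanishes (λ x → P'≤P (S x)) refl ,
  envW (bound e) (λ x → k₂ (S x)) Δ-vanishes (λ x → Q'≤Q (S x)) refl ,
  (λ x → P'++Q'≈ (S x))
  where
    open MW-Split
    S : ∀ x → MW-Split a (weight e x) (Γ' x) (Γ x) (Δ x)
    S x = MW-split-++ (Γ x) (Δ x) (pointwise e x) refl
    Γ-vanishes : ∀ x → bound e ≤ x → Γ x ≡ []
    Γ-vanishes x bound≤x = ++-conicalˡ (Γ x) (Δ x) (vanishes e x bound≤x)
    Δ-vanishes : ∀ x → bound e ≤ x → Δ x ≡ []
    Δ-vanishes x bound≤x = ++-conicalʳ (Γ x) (Δ x) (vanishes e x bound≤x)
    k-split : k ≡ sumBelow (bound e) (λ x → k₁ (S x)) + sumBelow (bound e) (λ x → k₂ (S x))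
    k-split = trans (total e) (trans (sumBelow-cong (bound e) (λ x _ → k≡ (S x))) (sumBelow-+ (bound e)))

m⊔1+n≤o⇒o≢n×m≤o : ∀ {m n o} → m ⊔ suc n ≤ o → o ≢ n × m ≤ o
m⊔1+n≤o⇒o≢n×m≤o {m} {n} le = >⇒≢ (m⊔n≤o⇒n≤o m (suc n) le) , m⊔n≤o⇒m≤o m (suc n) le

EnvW-extend : ∀ {Γ' Γ M' M} x → EnvW a k Γ' Γ → Γ x ≡ [] → MW a j M' M →
  EnvW a (k + j) (Γ' , x ∶ M') (Γ , x ∶ M)
EnvW-extend {a} {k} {j} {Γ'} {Γ} {M'} {M} x e Γx≡[] M'≤M = record
  { bound     = N
  ; weight    = weight′
  ; vanishes  = λ y N≤y → let y≢x , bound≤y = m⊔1+n≤o⇒o≢n×m≤o N≤y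
                          in trans (,∶-≢ Γ x M y≢x) (vanishes e y bound≤y)
  ; pointwise = pointwise′
  ; total     = begin
      k + j                                 ≡⟨ cong (_+ j) (total-extend e N (m≤m⊔n _ _)) ⟩
      sumBelow N (weight e) + j             ≡⟨ sumBelow-update N (m≤n⊔m (bound e) (suc x)) ⟨
      sumBelow N weight′ + weight e x       ≡⟨ cong (sumBelow N weight′ +_) (proj₂ (weight-[] e x Γx≡[])) ⟩
      sumBelow N weight′ + 0                ≡⟨ +-identityʳ _ ⟩
      sumBelow N weight′                    ∎
  }
  where
    open ≡-Reasoning
    N = bound e ⊔ suc x
    weight′ = update (weight e) x j
    pointwise′ : ∀ y → MW a (weight′ y) ((Γ' , x ∶ M') y) ((Γ , x ∶ M) y)
    pointwise′ y with y ≟ x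
    ... | yes refl = M'≤M
    ... | no  _    = pointwise e y

EnvW-unextend : ∀ {Γ'' Γ' M'} x → EnvW a k Γ'' (Γ' , x ∶ M') → Γ' x ≡ [] →
  ∃[ k₁ ] ∃[ k₂ ] (EnvW a k₁ (Γ'' , x ∶ []) Γ' × MW a k₂ (Γ'' x) M' × k ≡ k₁ + k₂)
EnvW-unextend {a} {k} {Γ''} {Γ'} {M'} x e Γ'x≡[] =
  sumBelow N weight′ , weight e x ,
  record
    { bound     = N
    ; weight    = weight′
    ; vanishes  = λ y N≤y → let y≢x , bound≤y = m⊔1+n≤o⇒o≢n×m≤o N≤y
                            in trans (sym (,∶-≢ Γ' x M' y≢x)) (vanishes e y bound≤y)
    ; pointwise = pointwise′
    ; total     = refl
    } ,
  MW-cast refl refl (,∶-≡ Γ' x M') (pointwise e x) ,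
  (begin
    k                                ≡⟨ total-extend e N (m≤m⊔n _ _) ⟩
    sumBelow N (weight e)            ≡⟨ +-identityʳ _ ⟨
    sumBelow N (weight e) + 0        ≡⟨ sumBelow-update N (m≤n⊔m (bound e) (suc x)) ⟨
    sumBelow N weight′ + weight e x  ∎)
  where
    open ≡-Reasoning
    N = bound e ⊔ suc x
    weight′ = update (weight e) x 0
    pointwise′ : ∀ y → MW a (weight′ y) ((Γ'' , x ∶ []) y) (Γ' y)
    pointwise′ y with y ≟ x
    ... | yes refl = MW-cast refl refl (sym Γ'x≡[]) wnil
    ... | no  y≢x  = MW-cast refl refl (,∶-≢ Γ' x M' y≢x) (pointwise e y)

EnvW-single : ∀ {L' L} x → LW a k L' L → EnvW a k (single x L') (single x L)
EnvW-single {a} {k} {L'} {L} x L'≤L = record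
  { bound     = suc x
  ; weight    = weight′
  ; vanishes  = λ y x<y → single-≢ x L (>⇒≢ x<y)
  ; pointwise = pointwise′
  ; total     = sym (trans (sumBelow-single (suc x) ≤-refl (update-≢ _ x k)) (update-≡ (λ _ → 0) x k))
  }
  where
    weight′ = update (λ _ → 0) x k
    pointwise′ : ∀ y → MW a (weight′ y) (single x L' y) (single x L y)
    pointwise′ y with y ≟ x
    ... | yes refl = MW-cast (+-identityʳ k) refl refl (wcons {xs = []} L'≤L wnil)
    ... | no  _    = wnil

EnvW-single-inv : ∀ {Γ' L} x → EnvW a k Γ' (single x L) →
  ∃[ L' ] (LW a k L' L × (∀ y → Γ' y ≡ single x L' y))
EnvW-single-inv {a} {k} {Γ'} {L} x e
  with MW-[-]ʳ (MW-cast refl refl (single-≡ x L) (pointwise e x))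
... | L' , Γ'x≡[L'] , L'≤L = L' , LW-cast (sym k≡weight-x) L'≤L , Γ'≡
  where
    empty-elsewhere : ∀ {y} → y ≢ x → Γ' y ≡ [] × weight e y ≡ 0
    empty-elsewhere y≢x = weight-[] e _ (single-≢ x L y≢x)

    x<bound : x < bound e
    x<bound with x <? bound e
    ... | yes x<b = x<b
    ... | no  x≮b with trans (sym (single-≡ x L)) (vanishes e x (≮⇒≥ x≮b))
    ...   | ()

    k≡weight-x : k ≡ weight e x
    k≡weight-x = trans (total e) (sumBelow-single (bound e) x<bound (λ y≢x → proj₂ (empty-elsewhere y≢x)))

    Γ'≡ : ∀ y → Γ' y ≡ single x L' y
    Γ'≡ y with y ≟ x
    ... | yes refl = Γ'x≡[L']
    ... | no  y≢x  = proj₁ (empty-elsewhere y≢x)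

EWUpTo-sumBelow : ∀ {Γ' Γ} n w → (∀ x → MW a (w x) (Γ' x) (Γ x)) → EWUpTo a n (sumBelow n w) Γ' Γ
EWUpTo-sumBelow zero    w w≤ = refl
EWUpTo-sumBelow (suc n) w w≤ = w n , sumBelow n w , refl , w≤ n , EWUpTo-sumBelow n w w≤

EnvW⇒EW : ∀ {Γ' Γ} → EnvW a k Γ' Γ → EW a k Γ' Γ
EnvW⇒EW {a} {k} {Γ'} {Γ} e =
  bound e , (λ x bound≤x → vanishesˡ e x bound≤x , vanishes e x bound≤x) ,
  subst (λ k → EWUpTo a (bound e) k Γ' Γ) (sym (total e))
    (EWUpTo-sumBelow (bound e) (weight e) (pointwise e))

EWUpTo⇒weights : ∀ {Γ' Γ} n → EWUpTo a n k Γ' Γ →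
  Σ (ℕ → ℕ) λ w → (∀ x → x < n → MW a (w x) (Γ' x) (Γ x)) × (∀ x → n ≤ x → w x ≡ 0) × k ≡ sumBelow n w
EWUpTo⇒weights zero    k≡0 = (λ _ → 0) , (λ _ ()) , (λ _ _ → refl) , k≡0
EWUpTo⇒weights {a} {Γ' = Γ'} {Γ} (suc n) (k₁ , k₂ , refl , w≤ , rest) with EWUpTo⇒weights n rest
... | w , below , above , refl =
  update w n k₁ ,
  below′ ,
  (λ x n<x → trans (update-≢ w n k₁ (>⇒≢ n<x)) (above x (<⇒≤ n<x))) ,
  cong₂ _+_ (sym (update-≡ w n k₁)) (sym (sumBelow-cong n (λ y y<n → update-≢ w n k₁ (<⇒≢ y<n))))
  where
    below′ : ∀ x → x < suc n → MW a (update w n k₁ x) (Γ' x) (Γ x)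
    below′ x x<1+n with x ≟ n
    ... | yes refl = w≤
    ... | no  x≢n  = below x (≤∧≢⇒< (s≤s⁻¹ x<1+n) x≢n)

EW⇒EnvW : ∀ {Γ' Γ} → EW a k Γ' Γ → EnvW a k Γ' Γ
EW⇒EnvW {a} {k} {Γ'} {Γ} (n , beyond , upTo) with EWUpTo⇒weights n upTo
... | w , below , above , k≡ = envW n w (λ x n≤x → proj₂ (beyond x n≤x)) pointwise′ k≡
  where
    pointwise′ : ∀ x → MW a (w x) (Γ' x) (Γ x)
    pointwise′ x with x <? n
    ... | yes x<n = below x x<n
    ... | no  x≮n = let Γ'x , Γx = beyond x (≮⇒≥ x≮n)
                    in MW-cast (sym (above x (≮⇒≥ x≮n))) (sym Γ'x) (sym Γx) wnil

record Retyped (t : Term) (Γ' : Env) (L' : Lin) (k i : ℕ) : Set where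
  constructor retyped
  field
    {Γ''}      : Env
    {L''}      : Lin
    {k' j₁ j₂} : ℕ
    derivation : Γ'' ⊢[ k' ] t ∶ L''
    env≤       : EnvW negv j₁ Γ'' Γ'
    type≤      : LW pos j₂ L'' L'
    balance    : Balanced k k' i (j₁ + j₂)

record Retypedᴹ (t : Term) (Γ' : Env) (M' : Multi) (k i : ℕ) : Set where
  constructor retypedᴹ
  field
    {Γ''}      : Env
    {M''}      : Multi
    {k' j₁ j₂} : ℕ
    derivation : Γ'' ⊢m[ k' ] t ∶ M''
    env≤       : EnvW negv j₁ Γ'' Γ'
    type≤      : MW pos j₂ M'' M'
    balance    : Balanced k k' i (j₁ + j₂)

retyped-var : ∀ {x L Γ' L' i₁ i₂} → EnvW pos i₁ Γ' (single x L) → LW negv i₂ L' L →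
  Retyped (var x) Γ' L' 0 (i₁ + i₂)
retyped-var {x} {i₁ = i₁} {i₂} Γ'≤ L'≤L with EnvW-single-inv x Γ'≤
... | L₀ , L₀≤L , Γ'≡ with LW-meet pos L₀≤L L'≤L
... | C , C≤L₀ , C≤L' =
  retyped ax (EnvW-resp-≈ (EnvW-single x C≤L₀) (λ y → ≈M-reflexive (sym (Γ'≡ y)))) C≤L'
    (balanced-≤ (≤-reflexive (+-comm i₂ i₁)))

retyped-abs : ∀ {t c x Γ' M' L' k i} → Γ' x ≡ [] → Retyped t (Γ' , x ∶ M') L' k i →
  Retyped (lam c x t) Γ' (arr M' c L') k i
retyped-abs {x = x} Γ'x≡[] (retyped {Γ''} {L''} {j₂ = j₂} D Γ''≤ L''≤ b) with EnvW-unextend x Γ''≤ Γ'x≡[]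
... | k₁ , k₂ , Γ''-x≤ , Γ''x≤M' , refl =
  retyped (abs (,∶-≡ Γ'' x []) (conv (λ y → ≈M-reflexive (sym (,∶-restore Γ'' x [] y))) (≈L-refl L'') D))
    Γ''-x≤ (warr Γ''x≤M' L''≤) (balanced-resp b refl (+-assoc k₁ k₂ j₂))

module Application {t u : Term}
  (retype-t : ∀ {Γ k L Γ' L' i₁ i₂} → Γ ⊢[ k ] t ∶ L → EnvW pos i₁ Γ' Γ → LW negv i₂ L' L →
              Retyped t Γ' L' k (i₁ + i₂))
  (retype-u : ∀ {Δ k M Δ' M' i₁ i₂} → Δ ⊢m[ k ] u ∶ M → EnvW pos i₁ Δ' Δ → MW negv i₂ M' M →
              Retypedᴹ u Δ' M' k (i₁ + i₂))
  where

  record RetypedApp (Γ' Δ' : Env) (c : Col) (L' : Lin) (k i : ℕ) : Set where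
    constructor retyped-app
    field
      {Γ'' Δ''}           : Env
      {M''}               : Multi
      {c''}               : Col
      {L''}               : Lin
      {kₜ kᵤ jΓ jΔ jL jc} : ℕ
      function            : Γ'' ⊢[ kₜ ] t ∶ arr M'' c'' L''
      argument            : Δ'' ⊢m[ kᵤ ] u ∶ M''
      Γ''≤                : EnvW negv jΓ Γ'' Γ'
      Δ''≤                : EnvW negv jΔ Δ'' Δ'
      L''≤                : LW pos jL L'' L'
      c''≤                : CW jc c'' c
      balance             : Balanced k (kₜ + kᵤ) i (jΓ + jΔ + jL + jc)

  -- When retyping the argument whitens its type strictly (weight suc w), t is retyped against the
  -- whiter type N₂; the black arrows of the argument type bound the number of such rounds.
  retype-app : ∀ fuel {Γ Δ Γ' Δ' M N c L L' kₜ kᵤ p iΓ iΔ iL} → blacksᴹ N < fuel →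
    Γ ⊢[ kₜ ] t ∶ arr M c L → Δ ⊢m[ kᵤ ] u ∶ N → MW pos p N M →
    EnvW pos iΓ Γ' Γ → EnvW pos iΔ Δ' Δ → LW negv iL L' L →
    RetypedApp Γ' Δ' c L' (kₜ + kᵤ) (iΓ + iΔ + iL + p)
  retype-app (suc fuel) {p = p} {iΓ} {iΔ} {iL} N<fuel Dₜ Dᵤ N≤M Γ'≤ Δ'≤ L'≤L
    with retype-t Dₜ Γ'≤ (warr N≤M L'≤L)
  ... | retyped {j₁ = j₁} Dₜ₁ Γ₁≤ T≤ bₜ with LW⁺-arr-inv T≤
  ... | lw⁺-arr {δ} {m} {l} {N₁} c₁≤ N₁≤N L₁≤L' with retype-u Dᵤ Δ'≤ N₁≤N
  ... | retypedᴹ {M'' = N₂} {j₁ = e} {j₂ = zero} Dᵤ₁ Δ₁≤ N₂≤N₁ bᵤ =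
    retyped-app (conv (λ y → ≈M-refl _) (≈arr (≈M-sym (MW-0⇒≈M N₂≤N₁ refl)) (≈L-refl _)) Dₜ₁) Dᵤ₁
      Γ₁≤ Δ₁≤ L₁≤L' c₁≤
      (balanced-cancel m (balanced-resp (balanced-+ bₜ bᵤ)
        (solve (iΓ ∷ iΔ ∷ iL ∷ p ∷ m ∷ [])) (solve (j₁ ∷ e ∷ l ∷ δ ∷ m ∷ []))))
  ... | retypedᴹ {M'' = N₂} {j₁ = e} {j₂ = suc w} Dᵤ₁ Δ₁≤ N₂≤N₁ bᵤ
    with retype-app fuel N₂<fuel Dₜ₁ Dᵤ₁ N₂≤N₁ (EnvW-reflˡ Γ₁≤) (EnvW-reflˡ Δ₁≤) (LW-refl _)
    where
      N₂<fuel : blacksᴹ N₂ < fuel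
      N₂<fuel = <-≤-trans (MW-blacks-< N₂≤N₁) (≤-trans (MW-blacks-≤ N₁≤N) (s≤s⁻¹ N<fuel))
  ... | retyped-app {jΓ = gΓ} {gΔ} {gL} {gc} Dₜ₂ Dᵤ₂ Γ₂≤ Δ₂≤ L₂≤ c₂≤ b =
    retyped-app Dₜ₂ Dᵤ₂ (EnvW-trans Γ₂≤ Γ₁≤) (EnvW-trans Δ₂≤ Δ₁≤) (LW-trans L₂≤ L₁≤L') (CW-trans c₂≤ c₁≤)
      (balanced-cancel (m + suc w)
        (balanced-resp (balanced-trans (balanced-+ bₜ bᵤ) b)
          (solve (iΓ ∷ iΔ ∷ iL ∷ p ∷ m ∷ w ∷ []))
          (solve (j₁ ∷ e ∷ l ∷ δ ∷ m ∷ w ∷ gΓ ∷ gΔ ∷ gL ∷ gc ∷ []))))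

mutual
  retype : ∀ t {Γ k L Γ' L' i₁ i₂} → Γ ⊢[ k ] t ∶ L → EnvW pos i₁ Γ' Γ → LW negv i₂ L' L →
           Retyped t Γ' L' k (i₁ + i₂)
  retype t (conv Γ≈ L≈ D) Γ'≤ L'≤L = retype t D (EnvW-resp-≈ Γ'≤ (≈E-sym Γ≈)) (LW-resp-≈ L'≤L (≈L-sym L≈))
  retype (var x) ax Γ'≤ L'≤L = retyped-var Γ'≤ L'≤L
  retype (lam c x t) {i₁ = i₁} (abs Γx≡[] D) Γ'≤ (warr {k₁ = a} {k₂ = b} M'≤M L'≤L) =
    retyped-abs (proj₁ (weight-[] Γ'≤ x Γx≡[]))
      (subst (Retyped t _ _ _) (+-assoc i₁ a b) (retype t D (EnvW-extend x Γ'≤ Γx≡[] M'≤M) L'≤L))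
  retype (app t d u) (ap {Γ = Γ} {Δ} {M = M} Dₜ Dᵤ) Γ'≤ L'≤L with EnvW-split-⊕ Γ Δ Γ'≤
  ... | Γ₁ , Δ₁ , iΓ , iΔ , refl , Γ₁≤ , Δ₁≤ , Γ₁⊕Δ₁≈
    with Application.retype-app (retype t) (retypeᴹ u) (suc (blacksᴹ M)) ≤-refl
           Dₜ Dᵤ (MW-refl M) Γ₁≤ Δ₁≤ L'≤L
  ... | Application.retyped-app Dₜ' Dᵤ' Γ''≤ Δ''≤ L''≤ c''≤ b =
    retyped (ap Dₜ' Dᵤ') (EnvW-resp-≈ (EnvW-⊕ Γ''≤ Δ''≤) Γ₁⊕Δ₁≈) L''≤
      (cost-balanced d c''≤ (balanced-resp b (+-identityʳ _) refl))

  retypeᴹ : ∀ t {Γ k M Γ' M' i₁ i₂} → Γ ⊢m[ k ] t ∶ M → EnvW pos i₁ Γ' Γ → MW negv i₂ M' M →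
            Retypedᴹ t Γ' M' k (i₁ + i₂)
  retypeᴹ t many[] Γ'≤ M'≤[] with MW-[]ʳ M'≤[] refl
  ... | refl , refl = retypedᴹ many[] (EnvW-∅ Γ'≤) wnil (balanced-≤ z≤n)
  retypeᴹ t (many∷ {Γ = Γ} {Δ} D Ds) Γ'≤ M'≤ with EnvW-split-⊕ Γ Δ Γ'≤ | MW-extractʳ [] M'≤ refl
  ... | Γ₁ , Δ₁ , iΓ , iΔ , refl , Γ₁≤ , Δ₁≤ , Γ₁⊕Δ₁≈ | p , L' , q , k₁ , k₂ , refl , L'≤ , rest≤ , refl
    with retype t D Γ₁≤ L'≤ | retypeᴹ t Ds Δ₁≤ rest≤
  ... | retyped {j₁ = j₁} {j₂} D' Γ''≤ L''≤ b | retypedᴹ {j₁ = j₁'} {j₂'} Ds' Δ''≤ M''≤ bs =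
    retypedᴹ (many∷ D' Ds') (EnvW-resp-≈ (EnvW-⊕ Γ''≤ Δ''≤) Γ₁⊕Δ₁≈) (wcons {xs = p} {ys = q} L''≤ M''≤)
      (balanced-resp (balanced-+ b bs) (interchange iΓ k₁ iΔ k₂) (interchange j₁ j₂ j₁' j₂'))

proposition2 : ∀ (t : Term) (Γ : Env) (k : ℕ) (L : Lin) (k₁ : ℕ) (Γ' : Env) (L' : Lin) →
    Γ ⊢[ k ] t ∶ L →
    PW negv k₁ (Γ' , L') (Γ , L) →
    ∃[ Γ'' ] ∃[ L'' ] ∃[ k' ] ∃[ k₂ ]
      (k₂ ≤ k₁ × Γ'' ⊢[ k' ] t ∶ L'' × PW pos k₂ (Γ'' , L'') (Γ' , L') × ∣ k - k' ∣ ≤ k₁ ∸ k₂)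
proposition2 t Γ k L k₁ Γ' L' D (_ , _ , refl , Γ'≤Γ , L'≤L) with retype t D (EW⇒EnvW Γ'≤Γ) L'≤L
... | retyped {j₁ = j₁} {j₂} D' Γ''≤Γ' L''≤L' b with balanced⇒∣-∣≤∸ b
... | j≤i , ∣k-k'∣≤i∸j =
  _ , _ , _ , j₁ + j₂ , j≤i , D' , (j₁ , j₂ , refl , EnvW⇒EW Γ''≤Γ' , L''≤L') , ∣k-k'∣≤i∸j
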